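{- Let $G$ be a connected graph. If $H$ and $H'$ are graphs with $\mathrm{n}(H)=\mathrm{n}(H')$, then $\xi(G\odot H)=\xi(G\odot H')$.
   Context: All graphs are finite, simple and undirected; $\mathrm{n}(H)$ denotes the order of $H$. For a connected graph $\Gamma$, a set $S\subseteq V(\Gamma)$ is a distance-equalizer set if for every two distinct $u,v\in V(\Gamma)\setminus S$ there is $w\in S$ with $d_\Gamma(w,u)=d_\Gamma(w,v)$; $\xi(\Gamma)$ is the minimum cardinality of a distance-equalizer set of $\Gamma$. For $V(G)=\{v_1,\dots,v_n\}$, the corona product $G\odot H$ is obtained from $G$ and $n$ pairwise disjoint copies $H_1,\dots,H_n$ of $H$ by joining $v_i$ to every vertex of $H_i$. -}

module Defs where

open import Data.Nat using (ℕ; zero; suc; _+_; _*_; _≤_)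
open import Data.Fin using (Fin; splitAt; remQuot)
open import Data.Fin.Subset using (Subset; _∈_; _∉_; ∣_∣)
open import Data.Product using (Σ; ∃; ∃-syntax; _×_; _,_)
open import Data.Sum using (_⊎_; inj₁; inj₂)
open import Data.Empty using (⊥)
open import Relation.Binary.PropositionalEquality using (_≡_; _≢_) renaming (sym to ≡-sym)

record Graph (n : ℕ) : Set₁ where
  field
    Adj   : Fin n → Fin n → Set
    sym   : ∀ {u v} → Adj u v → Adj v u
    irref : ∀ {u} → Adj u u → ⊥
open Graph public

data Walk {n : ℕ} (G : Graph n) : Fin n → Fin n → ℕ → Set where
  nil  : ∀ {u} → Walk G u u zero
  cons : ∀ {u w v k} → Adj G u w → Walk G w v k → Walk G u v (suc k)

Dist : ∀ {n} → Graph n → Fin n → Fin n → ℕ → Set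
Dist G u v d = Walk G u v d × (∀ k → Walk G u v k → d ≤ k)

Connected : ∀ {n} → Graph n → Set
Connected G = ∀ u v → ∃[ k ] Walk G u v k

IsDistEqualizer : ∀ {n} → Graph n → Subset n → Set
IsDistEqualizer G S =
  ∀ u v → u ∉ S → v ∉ S → u ≢ v →
    ∃[ w ] (w ∈ S × ∃[ d ] (Dist G w u d × Dist G w v d))

IsXi : ∀ {n} → Graph n → ℕ → Set
IsXi G k =
  (∃[ S ] (IsDistEqualizer G S × ∣ S ∣ ≡ k)) ×
  (∀ S → IsDistEqualizer G S → k ≤ ∣ S ∣)

-- Corona product G ⊙ H.  Vertex set Fin (n + n * m), decoded as
--   inj₁ i            ↦ vertex v_i of G,
--   inj₂ (combine i x) ↦ vertex x of the copy H_i.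
Vtx : ℕ → ℕ → Set
Vtx n m = Fin n ⊎ (Fin n × Fin m)

decode : ∀ n m → Fin (n + n * m) → Vtx n m
decode n m a with splitAt n a
... | inj₁ i = inj₁ i
... | inj₂ b = inj₂ (remQuot m b)

CAdj : ∀ {n m} → Graph n → Graph m → Vtx n m → Vtx n m → Set
CAdj G H (inj₁ i) (inj₁ j) = Adj G i j
CAdj G H (inj₁ i) (inj₂ (j , y)) = i ≡ j
CAdj G H (inj₂ (i , x)) (inj₁ j) = i ≡ j
CAdj G H (inj₂ (i , x)) (inj₂ (j , y)) = i ≡ j × Adj H x y

CAdj-sym : ∀ {n m} (G : Graph n) (H : Graph m) {p q : Vtx n m} →
           CAdj G H p q → CAdj G H q p
CAdj-sym G H {inj₁ i} {inj₁ j} e = sym G e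
CAdj-sym G H {inj₁ i} {inj₂ _} e = ≡-sym e
CAdj-sym G H {inj₂ _} {inj₁ j} e = ≡-sym e
CAdj-sym G H {inj₂ _} {inj₂ _} (e , a) =
  ≡-sym e , sym H a

CAdj-irr : ∀ {n m} (G : Graph n) (H : Graph m) {p : Vtx n m} →
           CAdj G H p p → ⊥
CAdj-irr G H {inj₁ i} a = irref G a
CAdj-irr G H {inj₂ _} (_ , a) = irref H a

corona : ∀ {n m} → Graph n → Graph m → Graph (n + n * m)
corona {n} {m} G H = record
  { Adj   = λ a b → CAdj G H (decode n m a) (decode n m b)
  ; sym   = λ {a} {b} → CAdj-sym G H {decode n m a} {decode n m b}
  ; irref = λ {a} → CAdj-irr G H {decode n m a}
  }

{-# OPTIONS --safe #-}
module Submission where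

-- In G ⊙ H, two vertices that do not lie in a common copy H_i are at distance
-- d_G(roots) + (their depths), where v_i has depth 0 and the vertices of H_i depth 1;
-- this does not involve H.  Inside H_i all distances are 1 or 2, and v_i is at distance 1
-- from all of H_i, so a witness w ∈ H_i of a pair u, v ≠ v_i can be replaced by v_i.
-- Call S settled at i if v_i ∈ S, or H_i ⊆ S, or H_i ∩ S = ∅.  Exchanging a vertex of
-- H_i ∩ S for v_i keeps an equalizer of G ⊙ H an equalizer without enlarging it, so every
-- equalizer can be settled at every i.  A settled equalizer of G ⊙ H is one of G ⊙ H′: a
-- witness lying in the copy of u ∉ S forces v_i ∈ S, and v_i also witnesses in G ⊙ H′.

open import Defs hiding (sym)
open import Data.Nat using (ℕ; suc; pred; _+_; _*_; _≤_; z≤n; s≤s)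
open import Data.Nat.Properties
  using ( ≤-refl; ≤-trans; ≤-antisym; n≤1+n; m≤n⇒m≤1+n; m<n⇒m≤1+n; +-suc
        ; +-monoˡ-≤; +-monoʳ-≤; +-cancelˡ-≤; +-cancelʳ-≤)
open import Data.Fin using (Fin; splitAt; combine; join; _↑ˡ_; _↑ʳ_)
  renaming (_≟_ to _≟ᶠ_)
open import Data.Fin.Properties
  using ( splitAt-↑ˡ; splitAt-↑ʳ; join-splitAt; remQuot-combine; combine-remQuot
        ; all?; any?; ¬∀⟶∃¬)
open import Data.Fin.Subset using (Subset; inside; outside; _∈_; ∣_∣; ⁅_⁆; _∪_; _-_)
open import Data.Fin.Subset.Properties
  using ( _∈?_; x∈⁅x⁆; x∈⁅y⁆⇒x≡y; ∣⁅x⁆∣≡1; x∈p∪q⁺; x∈p∪q⁻; x∈p∧x≢y⇒x∈p-y; p─q⊆p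
        ; x∈p⇒∣p-x∣<∣p∣)
open import Data.Vec.Base using (_∷_; [])
open import Data.List.Base using (List; _∷_; []; allFin)
open import Data.List.Membership.Propositional using () renaming (_∈_ to _∈ˡ_)
open import Data.List.Membership.Propositional.Properties using (∈-allFin)
open import Data.List.Relation.Unary.Any using (here; there)
open import Data.Product using (∃-syntax; _×_; _,_)
open import Data.Sum using (_⊎_; inj₁; inj₂)
open import Function using (_∘_; id)
import Data.Product.Properties as Product
import Data.Sum.Properties as Sum
open import Relation.Binary.Definitions using (DecidableEquality)
open import Relation.Nullary using (¬_; Dec; yes; no; contradiction)
open import Relation.Binary.PropositionalEquality
  using (_≡_; _≢_; refl; sym; trans; cong; subst; subst₂)

private variable
  n m N k l d L : ℕ
  i : Fin n
  x y : Fin m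
  G : Graph n
  H K : Graph m

EqualizerReduction : Graph N → Graph N → Set
EqualizerReduction Γ Γ′ =
  ∀ S → IsDistEqualizer Γ S → ∃[ S′ ] (IsDistEqualizer Γ′ S′ × ∣ S′ ∣ ≤ ∣ S ∣)

IsXi-transfer : {Γ Γ′ : Graph N} → EqualizerReduction Γ Γ′ → EqualizerReduction Γ′ Γ →
                IsXi Γ k → IsXi Γ′ k
IsXi-transfer {Γ′ = Γ′} reduce reduce⁻ ((S , equalizer , refl) , minimal)
  with reduce S equalizer
... | S′ , equalizer′ , S′≤S =
  (S′ , equalizer′ , ≤-antisym S′≤S (minimal′ S′ equalizer′)) , minimal′
  where
  minimal′ : ∀ T → IsDistEqualizer Γ′ T → ∣ S ∣ ≤ ∣ T ∣
  minimal′ T equalizerT with reduce⁻ T equalizerT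
  ... | T′ , equalizerT′ , T′≤T = ≤-trans (minimal T′ equalizerT′) T′≤T

∣p∪q∣≤∣p∣+∣q∣ : (p q : Subset N) → ∣ p ∪ q ∣ ≤ ∣ p ∣ + ∣ q ∣
∣p∪q∣≤∣p∣+∣q∣ []            []            = z≤n
∣p∪q∣≤∣p∣+∣q∣ (outside ∷ p) (outside ∷ q) = ∣p∪q∣≤∣p∣+∣q∣ p q
∣p∪q∣≤∣p∣+∣q∣ (outside ∷ p) (inside  ∷ q) =
  subst (suc ∣ p ∪ q ∣ ≤_) (sym (+-suc ∣ p ∣ ∣ q ∣)) (s≤s (∣p∪q∣≤∣p∣+∣q∣ p q))
∣p∪q∣≤∣p∣+∣q∣ (inside  ∷ p) (outside ∷ q) = s≤s (∣p∪q∣≤∣p∣+∣q∣ p q)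
∣p∪q∣≤∣p∣+∣q∣ (inside  ∷ p) (inside  ∷ q) =
  s≤s (≤-trans (∣p∪q∣≤∣p∣+∣q∣ p q) (+-monoʳ-≤ ∣ p ∣ (n≤1+n ∣ q ∣)))

exchanged : Fin N → Fin N → Subset N → Subset N
exchanged a b S = ⁅ a ⁆ ∪ (S - b)

module _ (a b : Fin N) where

  ∈-exchanged-new : (S : Subset N) → a ∈ exchanged a b S
  ∈-exchanged-new _ = x∈p∪q⁺ (inj₁ (x∈⁅x⁆ a))

  ∈-exchanged-old : ∀ {S c} → c ∈ S → c ≢ b → c ∈ exchanged a b S
  ∈-exchanged-old c∈S c≢b = x∈p∪q⁺ (inj₂ (x∈p∧x≢y⇒x∈p-y c∈S c≢b))

  ∈-exchanged⁻ : ∀ S {c} → c ∈ exchanged a b S → c ≡ a ⊎ c ∈ S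
  ∈-exchanged⁻ S c∈ with x∈p∪q⁻ ⁅ a ⁆ (S - b) c∈
  ... | inj₁ c∈a   = inj₁ (x∈⁅y⁆⇒x≡y a c∈a)
  ... | inj₂ c∈S-b = inj₂ (p─q⊆p S ⁅ b ⁆ c∈S-b)

  ∣exchanged∣≤∣p∣ : ∀ {S} → b ∈ S → ∣ exchanged a b S ∣ ≤ ∣ S ∣
  ∣exchanged∣≤∣p∣ {S} b∈S = ≤-trans (∣p∪q∣≤∣p∣+∣q∣ ⁅ a ⁆ (S - b))
    (subst (λ s → s + ∣ S - b ∣ ≤ ∣ S ∣) (sym (∣⁅x⁆∣≡1 a)) (x∈p⇒∣p-x∣<∣p∣ b∈S))

pattern hub i = inj₁ i
pattern leaf i x = inj₂ (i , x)

encode : Vtx n m → Fin (n + n * m)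
encode {n} {m} (hub i)    = i ↑ˡ (n * m)
encode {n} {m} (leaf i x) = n ↑ʳ combine i x

decode-encode : (p : Vtx n m) → decode n m (encode p) ≡ p
decode-encode {n} {m} (hub i) rewrite splitAt-↑ˡ n i (n * m) = refl
decode-encode {n} {m} (leaf i x)
  rewrite splitAt-↑ʳ n (n * m) (combine i x) | remQuot-combine {n} {m} i x = refl

encode-decode : (a : Fin (n + n * m)) → encode (decode n m a) ≡ a
encode-decode {n} {m} a with splitAt n a in eq
... | inj₁ i = trans (cong (join n (n * m)) (sym eq)) (join-splitAt n (n * m) a)
... | inj₂ b = trans (cong (n ↑ʳ_) (combine-remQuot {n} m b))
                     (trans (cong (join n (n * m)) (sym eq)) (join-splitAt n (n * m) a))

encode-injective : {p q : Vtx n m} → encode p ≡ encode q → p ≡ q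
encode-injective {p = p} {q} e =
  trans (sym (decode-encode p)) (trans (cong (decode _ _) e) (decode-encode q))

decode-injective : {a b : Fin (n + n * m)} → decode n m a ≡ decode n m b → a ≡ b
decode-injective {n} {m} {a} {b} e =
  trans (sym (encode-decode {n} {m} a)) (trans (cong encode e) (encode-decode {n} {m} b))

root : Vtx n m → Fin n
root (hub i)    = i
root (leaf i _) = i

depth : Vtx n m → ℕ
depth (hub _)    = 0
depth (leaf _ _) = 1

data SameCopy {n m : ℕ} : Vtx n m → Vtx n m → Set where
  same-copy : ∀ {i x y} → SameCopy (leaf i x) (leaf i y)

_≟ᵛ_ : DecidableEquality (Vtx n m)
_≟ᵛ_ = Sum.≡-dec _≟ᶠ_ (Product.≡-dec _≟ᶠ_ _≟ᶠ_)

sameCopy? : (p q : Vtx n m) → Dec (SameCopy p q)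
sameCopy? (hub _)    _          = no λ ()
sameCopy? (leaf _ _) (hub _)    = no λ ()
sameCopy? (leaf i _) (leaf j _) with i ≟ᶠ j
... | yes refl = yes same-copy
... | no i≢j   = no λ { same-copy → i≢j refl }

data CoronaWalk (G : Graph n) (H : Graph m) : Vtx n m → Vtx n m → ℕ → Set where
  nil  : ∀ {p} → CoronaWalk G H p p 0
  cons : ∀ {p r q k} → CAdj G H p r → CoronaWalk G H r q k →
         CoronaWalk G H p q (suc k)

CoronaDist : Graph n → Graph m → Vtx n m → Vtx n m → ℕ → Set
CoronaDist G H p q d = CoronaWalk G H p q d × (∀ k → CoronaWalk G H p q k → d ≤ k)

module _ {G : Graph n} {H : Graph m} where

  _++ᶜ_ : ∀ {p r q} → CoronaWalk G H p r k → CoronaWalk G H r q l →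
          CoronaWalk G H p q (k + l)
  nil      ++ᶜ w′ = w′
  cons e w ++ᶜ w′ = cons e (w ++ᶜ w′)

  walk-decode : ∀ {a b} → Walk (corona G H) a b k →
                CoronaWalk G H (decode n m a) (decode n m b) k
  walk-decode nil        = nil
  walk-decode (cons e w) = cons e (walk-decode w)

  walk-encode : ∀ {p q} → CoronaWalk G H p q k → Walk (corona G H) (encode p) (encode q) k
  walk-encode nil = nil
  walk-encode {p = p} (cons {r = r} e w) =
    cons (subst₂ (CAdj G H) (sym (decode-encode p)) (sym (decode-encode r)) e) (walk-encode w)

  walk-undecode : ∀ {a b} → CoronaWalk G H (decode n m a) (decode n m b) k →
                  Walk (corona G H) a b k
  walk-undecode {a = a} {b} w = subst₂ (λ a′ b′ → Walk (corona G H) a′ b′ _)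
    (encode-decode {n} {m} a) (encode-decode {n} {m} b) (walk-encode w)

  dist-decode : ∀ {a b} → Dist (corona G H) a b d →
                CoronaDist G H (decode n m a) (decode n m b) d
  dist-decode (w , shortest) = walk-decode w , λ k w′ → shortest k (walk-undecode w′)

  dist-undecode : ∀ {a b} → CoronaDist G H (decode n m a) (decode n m b) d →
                  Dist (corona G H) a b d
  dist-undecode (w , shortest) = walk-undecode w , λ k w′ → shortest k (walk-decode w′)

  hubWalk : ∀ {i j} → Walk G i j L → CoronaWalk G H (hub i) (hub j) L
  hubWalk nil        = nil
  hubWalk (cons e w) = cons e (hubWalk w)

  toRoot : ∀ p → CoronaWalk G H p (hub (root p)) (depth p)
  toRoot (hub _)    = nil
  toRoot (leaf _ _) = cons refl nil

  fromRoot : ∀ q → CoronaWalk G H (hub (root q)) q (depth q)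
  fromRoot (hub _)    = nil
  fromRoot (leaf _ _) = cons refl nil

  -- Bracketed so that it reduces to L + depth q or suc (L + depth q) once p is known.
  lift : ∀ {p q} → Walk G (root p) (root q) L → CoronaWalk G H p q (depth p + (L + depth q))
  lift {p = p} {q} w = toRoot p ++ᶜ (hubWalk w ++ᶜ fromRoot q)

  project : ∀ {p q} → CoronaWalk G H p q k →
            SameCopy p q ⊎ ∃[ L ] (Walk G (root p) (root q) L × depth p + (L + depth q) ≤ k)
  project {p = hub _}    nil = inj₂ (0 , nil , z≤n)
  project {p = leaf _ _} nil = inj₁ same-copy
  project {p = hub _} (cons {r = hub _} e w) with project w
  ... | inj₂ (L , w′ , le) = inj₂ (suc L , cons e w′ , s≤s le)
  project {p = hub _} (cons {r = leaf _ _} refl w) with project w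
  ... | inj₁ same-copy     = inj₂ (0 , nil , s≤s z≤n)
  ... | inj₂ (L , w′ , le) = inj₂ (L , w′ , m<n⇒m≤1+n le)
  project {p = leaf _ _} (cons {r = hub _} refl w) with project w
  ... | inj₂ (L , w′ , le) = inj₂ (L , w′ , s≤s le)
  project {p = leaf _ _} (cons {r = leaf _ _} (refl , _) w) with project w
  ... | inj₁ same-copy     = inj₁ same-copy
  ... | inj₂ (L , w′ , le) = inj₂ (L , w′ , m≤n⇒m≤1+n le)

private variable
  p q r u v : Vtx n m

dist-apart : ¬ SameCopy p q → CoronaDist G H p q d →
             ∃[ L ] (Dist G (root p) (root q) L × d ≡ depth p + (L + depth q))
dist-apart {p = p} {q} {G} ¬same (c , shortest) with project c
... | inj₁ same = contradiction same ¬same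
... | inj₂ (L , w , le) = L , (w , L-shortest) , d≡
  where
  d≡ = ≤-antisym (shortest _ (lift w)) le
  L-shortest : ∀ L′ → Walk G (root p) (root q) L′ → L ≤ L′
  L-shortest L′ w′ = +-cancelʳ-≤ (depth q) L L′
    (+-cancelˡ-≤ (depth p) _ _ (subst (_≤ _) d≡ (shortest _ (lift w′))))

dist-apart⁻ : ¬ SameCopy p q → Dist G (root p) (root q) L →
              CoronaDist G H p q (depth p + (L + depth q))
dist-apart⁻ {p = p} {q} {G} {L = L} {H} ¬same (w , shortest) = lift w , lower-bound
  where
  lower-bound : ∀ k → CoronaWalk G H p q k → depth p + (L + depth q) ≤ k
  lower-bound k c with project c
  ... | inj₁ same = contradiction same ¬same
  ... | inj₂ (L′ , w′ , le) =
    ≤-trans (+-monoʳ-≤ (depth p) (+-monoˡ-≤ (depth q) (shortest L′ w′))) le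

dist-independent : ¬ SameCopy p q → CoronaDist G H p q d → CoronaDist G K p q d
dist-independent ¬same c with dist-apart ¬same c
... | _ , D , refl = dist-apart⁻ ¬same D

dist-via-hub : ¬ SameCopy (leaf i x) q → CoronaDist G H (leaf i x) q d →
               CoronaDist G K (hub i) q (pred d)
dist-via-hub ¬same c with dist-apart ¬same c
... | _ , D , refl = dist-apart⁻ (λ ()) D

dist-to-copy : ¬ SameCopy p (leaf i y) → CoronaDist G H p (leaf i y) d →
               CoronaDist G H p (leaf i x) d
dist-to-copy ¬same c with dist-apart ¬same c
... | _ , D , refl = dist-apart⁻ (λ { same-copy → ¬same same-copy }) D

dist-zero : CoronaDist G H p q 0 → p ≡ q
dist-zero (nil , _) = refl

dist-hub-leaf : CoronaDist G H (hub i) (leaf i y) 1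
dist-hub-leaf = cons refl nil , λ { _ (cons _ _) → s≤s z≤n }

dist-sameCopy≤2 : CoronaDist G H (leaf i x) (leaf i y) d → d ≤ 2
dist-sameCopy≤2 {i = i} (_ , shortest) =
  shortest 2 (cons {r = hub i} refl (cons refl nil))

hub-equalizes : CoronaDist G H (leaf i x) (leaf i y) d → CoronaDist G H (leaf i x) r d →
                r ≢ hub i → CoronaDist G K (hub i) r 1
hub-equalizes {G = G} {i = i} {x} {r = r} {K = K} cy cr r≢hub
  with sameCopy? (leaf i x) r
... | yes same-copy = dist-hub-leaf
... | no ¬same      = at-one (dist-sameCopy≤2 cy) (dist-via-hub ¬same cr)
  where
  at-one : ∀ {e} → e ≤ 2 → CoronaDist G K (hub i) r (pred e) → CoronaDist G K (hub i) r 1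
  at-one z≤n             c = contradiction (sym (dist-zero c)) r≢hub
  at-one (s≤s z≤n)       c = contradiction (sym (dist-zero c)) r≢hub
  at-one (s≤s (s≤s z≤n)) c = c

Equalized : Graph n → Graph m → (Vtx n m → Set) → Vtx n m → Vtx n m → Set
Equalized G H P u v = ∃[ w ] (P w × ∃[ d ] (CoronaDist G H w u d × CoronaDist G H w v d))

IsCoronaEqualizer : Graph n → Graph m → (Vtx n m → Set) → Set
IsCoronaEqualizer G H P = ∀ u v → ¬ P u → ¬ P v → u ≢ v → Equalized G H P u v

Settled : (Vtx n m → Set) → Fin n → Set
Settled {m = m} P i = ∀ x → P (leaf i x) → P (hub i) ⊎ (∀ (y : Fin m) → P (leaf i y))

module _ {P : Vtx n m → Set} where

  Equalized-sym : Equalized G H P u v → Equalized G H P v u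
  Equalized-sym (w , Pw , d , cu , cv) = w , Pw , d , cv , cu

  hub-takes-over : P (hub i) → ¬ P u → ¬ P v →
                   CoronaDist G H (leaf i x) u d → CoronaDist G H (leaf i x) v d →
                   Equalized G K P u v
  hub-takes-over {i = i} {u = u} {v = v} {x = x} P-hub ¬Pu ¬Pv cu cv
    with sameCopy? (leaf i x) u | sameCopy? (leaf i x) v
  ... | yes same-copy | _ =
    hub i , P-hub , 1 , dist-hub-leaf , hub-equalizes cu cv λ { refl → ¬Pv P-hub }
  ... | no _ | yes same-copy =
    hub i , P-hub , 1 , hub-equalizes cv cu (λ { refl → ¬Pu P-hub }) , dist-hub-leaf
  ... | no ¬same-u | no ¬same-v =
    hub i , P-hub , _ , dist-via-hub ¬same-u cu , dist-via-hub ¬same-v cv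

  settled-hub-takes-over : Settled P i → P (leaf i x) → ¬ P (leaf i y) → ¬ P v →
                           CoronaDist G H (leaf i x) (leaf i y) d →
                           CoronaDist G H (leaf i x) v d → Equalized G K P (leaf i y) v
  settled-hub-takes-over {y = y} settledᵢ Px ¬Py ¬Pv cy cv with settledᵢ _ Px
  ... | inj₁ P-hub = hub-takes-over P-hub ¬Py ¬Pv cy cv
  ... | inj₂ all   = contradiction (all y) ¬Py

  settled-transfer : IsCoronaEqualizer G H P → (∀ i → Settled P i) →
                     IsCoronaEqualizer G K P
  settled-transfer equalizer settled u v ¬Pu ¬Pv u≢v with equalizer u v ¬Pu ¬Pv u≢v
  ... | w , Pw , d , cu , cv with sameCopy? w u | sameCopy? w v
  ...   | yes same-copy | _ = settled-hub-takes-over (settled _) Pw ¬Pu ¬Pv cu cv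
  ...   | no _ | yes same-copy =
    Equalized-sym (settled-hub-takes-over (settled _) Pw ¬Pv ¬Pu cv cu)
  ...   | no ¬same-u | no ¬same-v =
    w , Pw , d , dist-independent ¬same-u cu , dist-independent ¬same-v cv

module _ {P P′ : Vtx n m → Set} (equalizer : IsCoronaEqualizer G H P)
         (¬Py : ¬ P (leaf i y)) (P′-hub : P′ (hub i))
         (keep : ∀ {p} → P p → p ≢ leaf i x → P′ p) where

  private
    ¬P : ¬ P′ p → p ≢ leaf i x → ¬ P p
    ¬P ¬P′p p≢x Pp = ¬P′p (keep Pp p≢x)

    -- Vertices outside copy i see leaf i x and leaf i y at the same distance, so
    -- leaf i x can borrow the witness of the pair (leaf i y, v).
    from-removed : ¬ P′ v → v ≢ leaf i x → Equalized G H P′ (leaf i x) v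
    from-removed {v = v} ¬P′v v≢x with sameCopy? (leaf i x) v
    ... | yes same-copy = hub i , P′-hub , 1 , dist-hub-leaf , dist-hub-leaf
    ... | no ¬same
      with equalizer (leaf i y) v ¬Py (¬P ¬P′v v≢x) (λ { refl → ¬same same-copy })
    ...   | w , Pw , d , cy , cv with sameCopy? w (leaf i y)
    ...     | yes same-copy =
      hub i , P′-hub , 1 , dist-hub-leaf , hub-equalizes cy cv λ { refl → ¬P′v P′-hub }
    ...     | no ¬same′ =
      w , keep Pw (λ { refl → ¬same′ same-copy }) , d , dist-to-copy ¬same′ cy , cv

    from-kept : ¬ P′ u → ¬ P′ v → u ≢ leaf i x → v ≢ leaf i x → u ≢ v →
                Equalized G H P′ u v
    from-kept {u = u} {v = v} ¬P′u ¬P′v u≢x v≢x u≢v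
      with equalizer u v (¬P ¬P′u u≢x) (¬P ¬P′v v≢x) u≢v
    ... | w , Pw , d , cu , cv with w ≟ᵛ leaf i x
    ...   | no w≢x   = w , keep Pw w≢x , d , cu , cv
    ...   | yes refl = hub-takes-over P′-hub ¬P′u ¬P′v cu cv

  exchange : IsCoronaEqualizer G H P′
  exchange u v ¬P′u ¬P′v u≢v with u ≟ᵛ leaf i x | v ≟ᵛ leaf i x
  ... | yes refl | _        = from-removed ¬P′v (u≢v ∘ sym)
  ... | no _     | yes refl = Equalized-sym (from-removed ¬P′u u≢v)
  ... | no u≢x   | no v≢x   = from-kept ¬P′u ¬P′v u≢x v≢x u≢v

-- n and m cannot be recovered from Subset (n + n * m), so they are fixed here.
module _ {n m : ℕ} where

  _∈ᶜ_ : Vtx n m → Subset (n + n * m) → Set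
  p ∈ᶜ S = encode p ∈ S

  Settling : Graph n → Graph m → Subset (n + n * m) → Fin n → Set
  Settling G H S i =
    ∃[ S′ ] (IsCoronaEqualizer G H (_∈ᶜ S′) × ∣ S′ ∣ ≤ ∣ S ∣ × Settled (_∈ᶜ S′) i ×
             (∀ {j} → Settled (_∈ᶜ S) j → Settled (_∈ᶜ S′) j))

  exchange-settles : {S : Subset (n + n * m)} → IsCoronaEqualizer G H (_∈ᶜ S) →
                     ¬ leaf i y ∈ᶜ S → leaf i x ∈ᶜ S → Settling G H S i
  exchange-settles {i = i} {x = x} {S = S} equalizer ¬Py Px =
    S′ , exchange {P′ = _∈ᶜ S′} equalizer ¬Py hub∈S′ (λ {p} → keep p) ,
    ∣exchanged∣≤∣p∣ a b Px , (λ _ _ → inj₁ hub∈S′) , preserve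
    where
    a b : Fin (n + n * m)
    a = encode (hub i)
    b = encode (leaf i x)

    S′ : Subset (n + n * m)
    S′ = exchanged a b S

    hub∈S′ : hub i ∈ᶜ S′
    hub∈S′ = ∈-exchanged-new a b S

    keep : ∀ p → p ∈ᶜ S → p ≢ leaf i x → p ∈ᶜ S′
    keep _ Pp p≢x = ∈-exchanged-old a b Pp (p≢x ∘ encode-injective)

    preserve : ∀ {j} → Settled (_∈ᶜ S) j → Settled (_∈ᶜ S′) j
    preserve {j} settledⱼ x′ P′x′ with j ≟ᶠ i | ∈-exchanged⁻ a b S P′x′
    ... | yes refl | _           = inj₁ hub∈S′
    ... | no _     | inj₁ x′≡hub =
      contradiction (encode-injective {p = leaf j x′} {hub i} x′≡hub) λ ()
    ... | no j≢i   | inj₂ Px′ with settledⱼ x′ Px′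
    ...   | inj₁ P-hub = inj₁ (keep (hub j) P-hub λ ())
    ...   | inj₂ all   = inj₂ λ y′ → keep (leaf j y′) (all y′) λ { refl → j≢i refl }

  settle : {S : Subset (n + n * m)} → IsCoronaEqualizer G H (_∈ᶜ S) → ∀ i →
           Settling G H S i
  settle {S = S} equalizer i with encode (hub i) ∈? S
  ... | yes P-hub = S , equalizer , ≤-refl , (λ _ _ → inj₁ P-hub) , id
  ... | no _ with all? (λ y → encode (leaf i y) ∈? S)
  ...   | yes all = S , equalizer , ≤-refl , (λ _ _ → inj₂ all) , id
  ...   | no ¬all
    with ¬∀⟶∃¬ _ _ (λ y → encode (leaf i y) ∈? S) ¬all | any? (λ x → encode (leaf i x) ∈? S)
  ...     | _ | no none =
    S , equalizer , ≤-refl , (λ x Px → contradiction (x , Px) none) , id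
  ...     | y , ¬Py | yes (x , Px) =
    exchange-settles {i = i} {y = y} {x = x} equalizer ¬Py Px

  settle-all : {S : Subset (n + n * m)} → IsCoronaEqualizer G H (_∈ᶜ S) →
               (is : List (Fin n)) →
               ∃[ S′ ] (IsCoronaEqualizer G H (_∈ᶜ S′) × ∣ S′ ∣ ≤ ∣ S ∣ ×
                        (∀ {i} → i ∈ˡ is → Settled (_∈ᶜ S′) i))
  settle-all {S = S} equalizer [] = S , equalizer , ≤-refl , λ ()
  settle-all equalizer (i ∷ is) with settle-all equalizer is
  ... | S₁ , equalizer₁ , S₁≤S , settled₁ with settle equalizer₁ i
  ...   | S₂ , equalizer₂ , S₂≤S₁ , settledᵢ , preserve =
    S₂ , equalizer₂ , ≤-trans S₂≤S₁ S₁≤S ,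
    λ { (here refl) → settledᵢ ; (there i∈is) → preserve (settled₁ i∈is) }

  IsDistEqualizer⇒IsCoronaEqualizer : {S : Subset (n + n * m)} →
    IsDistEqualizer (corona G H) S → IsCoronaEqualizer G H (_∈ᶜ S)
  IsDistEqualizer⇒IsCoronaEqualizer {G = G} {H = H} {S = S} equalizer u v u∉S v∉S u≢v
    with equalizer (encode u) (encode v) u∉S v∉S (u≢v ∘ encode-injective)
  ... | a , a∈S , d , Du , Dv =
    decode n m a , subst (_∈ S) (sym (encode-decode {n} {m} a)) a∈S , d , dist Du , dist Dv
    where
    dist : ∀ {q} → Dist (corona G H) a (encode q) d → CoronaDist G H (decode n m a) q d
    dist D = subst (λ q → CoronaDist G H (decode n m a) q d) (decode-encode _) (dist-decode D)

  IsCoronaEqualizer⇒IsDistEqualizer : {S : Subset (n + n * m)} →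
    IsCoronaEqualizer G H (_∈ᶜ S) → IsDistEqualizer (corona G H) S
  IsCoronaEqualizer⇒IsDistEqualizer {G = G} {H = H} {S = S} equalizer a b a∉S b∉S a≢b
    with equalizer (decode n m a) (decode n m b)
           (a∉S ∘ subst (_∈ S) (encode-decode {n} {m} a))
           (b∉S ∘ subst (_∈ S) (encode-decode {n} {m} b))
           (a≢b ∘ decode-injective)
  ... | w , w∈S , d , Ca , Cb = encode w , w∈S , d , dist Ca , dist Cb
    where
    dist : ∀ {c} → CoronaDist G H w (decode n m c) d → Dist (corona G H) (encode w) c d
    dist C = dist-undecode (subst (λ p → CoronaDist G H p _ d) (sym (decode-encode w)) C)

  corona-reduction : (G : Graph n) (H K : Graph m) →
                     EqualizerReduction (corona G H) (corona G K)
  corona-reduction G H K S equalizer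
    with settle-all (IsDistEqualizer⇒IsCoronaEqualizer equalizer) (allFin n)
  ... | S′ , equalizer′ , S′≤S , settled =
    S′ , IsCoronaEqualizer⇒IsDistEqualizer
           (settled-transfer equalizer′ (λ i → settled (∈-allFin i))) , S′≤S

proposition15 : ∀ {n m} (G : Graph n) (H H′ : Graph m) → Connected G →
    ∀ k → (IsXi (corona G H) k → IsXi (corona G H′) k) × (IsXi (corona G H′) k → IsXi (corona G H) k)
proposition15 G H H′ _ k =
  IsXi-transfer (corona-reduction G H H′) (corona-reduction G H′ H) ,
  IsXi-transfer (corona-reduction G H′ H) (corona-reduction G H H′)
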